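{- Let $p$ be a prime. If $\{a^1,\ldots,a^n\}\subseteq \mathbb{Z}^m$ is a $p$-adic generating set for a cone, then it is a $p$-adic generating set for a subspace.
   Context: A $p$-adic rational is a number of the form $a/p^k$ with $a,k$ integers and $k\geq 0$. A finite set $S$ of integral vectors is a $p$-adic generating set for a cone if every integral vector in the conic hull of $S$ can be written as a conic combination of the vectors of $S$ with $p$-adic nonnegative coefficients; it is a $p$-adic generating set for a subspace if every integral vector in the linear span of $S$ can be written as a linear combination of the vectors of $S$ with $p$-adic coefficients.
   Formalization: The conic hull and the linear span of the vectors are taken with rational coefficients, nonnegative for the cone. -}

module Defs where

open import Data.Nat using (ℕ; zero; suc)
import Data.Nat
open import Data.Integer using (ℤ)
open import Data.Fin using (Fin)
open import Data.Rational using (ℚ; 0ℚ; _+_; _*_; _≤_)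
import Data.Rational as ℚ
open import Data.Product using (Σ; ∃; ∃-syntax; _×_)
open import Relation.Binary.PropositionalEquality using (_≡_)

IntVec : ℕ → Set
IntVec m = Fin m → ℤ

Σℚ : ∀ {n} → (Fin n → ℚ) → ℚ
Σℚ {zero}  f = 0ℚ
Σℚ {suc n} f = f Fin.zero + Σℚ (λ i → f (Fin.suc i))
  where import Data.Fin as Fin

ι : ℤ → ℚ
ι z = z ℚ./ 1

ιℕ : ℕ → ℚ
ιℕ n = ι (Data.Integer.+ n)
  where import Data.Integer

IsCombination : ∀ {n m} → (Fin n → IntVec m) → (Fin n → ℚ) → IntVec m → Set
IsCombination a λ' x = ∀ j → Σℚ (λ i → λ' i * ι (a i j)) ≡ ι (x j)

IsPAdic : ℕ → ℚ → Set
IsPAdic p q = ∃[ c ] ∃[ k ] (q * ιℕ (p Data.Nat.^ k) ≡ ι c)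

InCone : ∀ {n m} → (Fin n → IntVec m) → IntVec m → Set
InCone a x = ∃[ λ' ] ((∀ i → 0ℚ ≤ λ' i) × IsCombination a λ' x)

InSpan : ∀ {n m} → (Fin n → IntVec m) → IntVec m → Set
InSpan a x = ∃[ λ' ] IsCombination a λ' x

PAdicConeGen : ℕ → ∀ {n m} → (Fin n → IntVec m) → Set
PAdicConeGen p {n} {m} a =
  ∀ (x : IntVec m) → InCone a x →
    ∃[ μ ] ((∀ i → 0ℚ ≤ μ i × IsPAdic p (μ i)) × IsCombination a μ x)

PAdicSubspaceGen : ℕ → ∀ {n m} → (Fin n → IntVec m) → Set
PAdicSubspaceGen p {n} {m} a =
  ∀ (x : IntVec m) → InSpan a x →
    ∃[ μ ] ((∀ i → IsPAdic p (μ i)) × IsCombination a μ x)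

module Submission where

open import Defs
open import Data.Nat as ℕ using (ℕ; zero; suc)
open import Data.Nat.Primality using (Prime)
import Data.Nat.Properties as ℕP
open import Data.Fin using (Fin; zero; suc)
open import Data.Integer as ℤ using (ℤ; +_; -[1+_])
import Data.Integer.Properties as ℤP
open import Data.Integer.Tactic.RingSolver using (solve-∀)
open import Data.Rational as ℚ using (ℚ; 0ℚ; _+_; _*_; _≤_; mkℚ)
import Data.Rational.Properties as ℚP
open import Data.Rational.Solver using (module +-*-Solver)
open +-*-Solver using (solve; _:=_; _:+_; _:*_)
import Data.Rational.Unnormalised as ℚᵘ
open ℚᵘ using (mkℚᵘ; *≡*; *≤*)
import Data.Rational.Unnormalised.Properties as ℚᵘP
open import Data.Product using (_,_; proj₂)
open import Relation.Binary.PropositionalEquality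

-- Write x = Σ λᵢ aⁱ with rational λ and let N bound the numerators of all λᵢ, so that
-- every λᵢ + N ≥ 0. Then x + N Σᵢ aⁱ is an integral vector of the cone and so has a
-- representation Σ μᵢ aⁱ with p-adic μᵢ ≥ 0; hence x = Σ (μᵢ − N) aⁱ, and μᵢ − N is
-- p-adic because N is an integer.

ι-unique : ∀ z {q} → ℚ.toℚᵘ q ℚᵘ.≃ mkℚᵘ z 0 → q ≡ ι z
ι-unique z eq = ℚP.toℚᵘ-injective
  (ℚᵘP.≃-trans eq (ℚᵘP.≃-sym (ℚP.toℚᵘ-fromℚᵘ (mkℚᵘ z 0))))

toℚᵘ-ι : ∀ z → ℚ.toℚᵘ (ι z) ℚᵘ.≃ mkℚᵘ z 0
toℚᵘ-ι z = ℚP.toℚᵘ-fromℚᵘ (mkℚᵘ z 0)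

ι-+ : ∀ a b → ι (a ℤ.+ b) ≡ ι a + ι b
ι-+ a b = sym (ι-unique (a ℤ.+ b)
  (ℚᵘP.≃-trans (ℚP.toℚᵘ-homo-+ (ι a) (ι b))
  (ℚᵘP.≃-trans (ℚᵘP.+-cong (toℚᵘ-ι a) (toℚᵘ-ι b))
               (*≡* (cross-multiplied a b)))))
  where
  cross-multiplied : ∀ a b → (a ℤ.* + 1 ℤ.+ b ℤ.* + 1) ℤ.* + 1 ≡ (a ℤ.+ b) ℤ.* + 1
  cross-multiplied = solve-∀

ι-* : ∀ a b → ι (a ℤ.* b) ≡ ι a * ι b
ι-* a b = sym (ι-unique (a ℤ.* b)
  (ℚᵘP.≃-trans (ℚP.toℚᵘ-homo-* (ι a) (ι b))
  (ℚᵘP.≃-trans (ℚᵘP.*-cong (toℚᵘ-ι a) (toℚᵘ-ι b))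
               (*≡* refl))))

Σℤ : ∀ {n} → (Fin n → ℤ) → ℤ
Σℤ {zero}  f = + 0
Σℤ {suc n} f = f zero ℤ.+ Σℤ (λ i → f (suc i))

Σℚ-ι : ∀ {n} (f : Fin n → ℤ) → Σℚ (λ i → ι (f i)) ≡ ι (Σℤ f)
Σℚ-ι {zero}  f = refl
Σℚ-ι {suc n} f = begin
  ι (f zero) + Σℚ (λ i → ι (f (suc i)))  ≡⟨ cong (λ s → ι (f zero) + s) (Σℚ-ι (λ i → f (suc i))) ⟩
  ι (f zero) + ι (Σℤ (λ i → f (suc i)))  ≡⟨ sym (ι-+ (f zero) _) ⟩
  ι (Σℤ f)                                ∎
  where open ≡-Reasoning

Σℚ-shift : ∀ {n} (f : Fin n → ℚ) (c : ℚ) (g : Fin n → ℚ) →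
  Σℚ (λ i → (f i + c) * g i) ≡ Σℚ (λ i → f i * g i) + c * Σℚ g
Σℚ-shift {zero}  f c g = sym (trans (ℚP.+-identityˡ (c * 0ℚ)) (ℚP.*-zeroʳ c))
Σℚ-shift {suc n} f c g = trans
  (cong (λ s → (f zero + c) * g zero + s) (Σℚ-shift (λ i → f (suc i)) c (λ i → g (suc i))))
  (solve 5 (λ f₀ c g₀ F G → (f₀ :+ c) :* g₀ :+ (F :+ c :* G) := (f₀ :* g₀ :+ F) :+ c :* (g₀ :+ G))
     refl (f zero) c (g zero) (Σℚ (λ i → f (suc i) * g (suc i))) (Σℚ (λ i → g (suc i))))

IsPAdic-+ι : ∀ p q c → IsPAdic p q → IsPAdic p (q + ι c)
IsPAdic-+ι p q c (d , k , q*pᵏ≡d) = d ℤ.+ c ℤ.* + pᵏ , k , (begin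
  (q + ι c) * ι (+ pᵏ)                ≡⟨ ℚP.*-distribʳ-+ (ι (+ pᵏ)) q (ι c) ⟩
  q * ι (+ pᵏ) + ι c * ι (+ pᵏ)       ≡⟨ cong₂ _+_ q*pᵏ≡d (sym (ι-* c (+ pᵏ))) ⟩
  ι d + ι (c ℤ.* + pᵏ)                ≡⟨ sym (ι-+ d _) ⟩
  ι (d ℤ.+ c ℤ.* + pᵏ)                ∎)
  where
  open ≡-Reasoning
  pᵏ = p ℕ.^ k

0≤i+n : ∀ i n → ℤ.∣ i ∣ ℕ.≤ n → + 0 ℤ.≤ i ℤ.+ + n
0≤i+n (+ i)    n _     = ℤ.+≤+ ℕ.z≤n
0≤i+n -[1+ i ] n ∣i∣≤n rewrite ℤP.⊖-≥ ∣i∣≤n = ℤ.+≤+ ℕ.z≤n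

0≤q+ι : ∀ q N → ℤ.∣ ℚ.↥ q ∣ ℕ.≤ N → 0ℚ ≤ q + ι (+ N)
0≤q+ι q@(mkℚ num d _) N ∣num∣≤N =
  ℚP.toℚᵘ-cancel-≤ (ℚᵘP.≤-respʳ-≃ (ℚᵘP.≃-sym toℚᵘ-sum) (*≤* 0≤numerator))
  where
  toℚᵘ-sum : ℚ.toℚᵘ (q + ι (+ N)) ℚᵘ.≃ mkℚᵘ num d ℚᵘ.+ mkℚᵘ (+ N) 0
  toℚᵘ-sum = ℚᵘP.≃-trans (ℚP.toℚᵘ-homo-+ q (ι (+ N))) (ℚᵘP.+-congʳ (ℚ.toℚᵘ q) (toℚᵘ-ι (+ N)))
  numerator-sum : ∀ i n d → i ℤ.+ n ℤ.* d ≡ (i ℤ.* + 1 ℤ.+ n ℤ.* d) ℤ.* + 1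
  numerator-sum = solve-∀
  0≤num+N*d : + 0 ℤ.≤ num ℤ.+ + N ℤ.* + suc d
  0≤num+N*d = subst (λ k → + 0 ℤ.≤ num ℤ.+ k) (ℤP.pos-* N (suc d))
    (0≤i+n num (N ℕ.* suc d) (ℕP.≤-trans ∣num∣≤N (ℕP.m≤m*n N (suc d))))
  0≤numerator : + 0 ℤ.≤ (num ℤ.* + 1 ℤ.+ + N ℤ.* + suc d) ℤ.* + 1
  0≤numerator = subst (+ 0 ℤ.≤_) (numerator-sum num (+ N) (+ suc d)) 0≤num+N*d

Σ∣↥∣ : ∀ {n} → (Fin n → ℚ) → ℕ
Σ∣↥∣ {zero}  f = 0
Σ∣↥∣ {suc n} f = ℤ.∣ ℚ.↥ (f zero) ∣ ℕ.+ Σ∣↥∣ (λ i → f (suc i))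

∣↥∣≤Σ∣↥∣ : ∀ {n} (f : Fin n → ℚ) i → ℤ.∣ ℚ.↥ (f i) ∣ ℕ.≤ Σ∣↥∣ f
∣↥∣≤Σ∣↥∣ f zero    = ℕP.m≤m+n _ _
∣↥∣≤Σ∣↥∣ f (suc i) = ℕP.≤-trans (∣↥∣≤Σ∣↥∣ (λ i → f (suc i)) i) (ℕP.m≤n+m _ _)

module _ {n m} (a : Fin n → IntVec m) where

  columnSum : IntVec m
  columnSum j = Σℤ (λ i → a i j)

  IsCombination-shift : ∀ coeff x c → IsCombination a coeff x →
    IsCombination a (λ i → coeff i + ι c) (λ j → x j ℤ.+ c ℤ.* columnSum j)
  IsCombination-shift coeff x c comb j = begin
    Σℚ (λ i → (coeff i + ι c) * ι (a i j))            ≡⟨ Σℚ-shift coeff (ι c) (λ i → ι (a i j)) ⟩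
    Σℚ (λ i → coeff i * ι (a i j)) + ι c * Σℚ (λ i → ι (a i j))
                                                      ≡⟨ cong₂ (λ u v → u + ι c * v) (comb j) (Σℚ-ι (λ i → a i j)) ⟩
    ι (x j) + ι c * ι (columnSum j)                   ≡⟨ cong (λ s → ι (x j) + s) (sym (ι-* c _)) ⟩
    ι (x j) + ι (c ℤ.* columnSum j)                   ≡⟨ sym (ι-+ (x j) _) ⟩
    ι (x j ℤ.+ c ℤ.* columnSum j)                     ∎
    where open ≡-Reasoning

  IsCombination-unshift : ∀ coeff x c →
    IsCombination a coeff (λ j → x j ℤ.+ c ℤ.* columnSum j) →
    IsCombination a (λ i → coeff i + ι (ℤ.- c)) x
  IsCombination-unshift coeff x c comb j =
    trans (IsCombination-shift coeff (λ j → x j ℤ.+ c ℤ.* columnSum j) (ℤ.- c) comb j)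
          (cong ι (+-*-shift-cancel (x j) c (columnSum j)))
    where
    +-*-shift-cancel : ∀ x c s → x ℤ.+ c ℤ.* s ℤ.+ ℤ.- c ℤ.* s ≡ x
    +-*-shift-cancel = solve-∀

  InCone-shift : ∀ coeff x → IsCombination a coeff x →
    InCone a (λ j → x j ℤ.+ + Σ∣↥∣ coeff ℤ.* columnSum j)
  InCone-shift coeff x comb =
    (λ i → coeff i + ι (+ Σ∣↥∣ coeff)) ,
    (λ i → 0≤q+ι (coeff i) (Σ∣↥∣ coeff) (∣↥∣≤Σ∣↥∣ coeff i)) ,
    IsCombination-shift coeff x (+ Σ∣↥∣ coeff) comb

proposition3p3 : (p : ℕ) → Prime p → (n m : ℕ) → (a : Fin n → IntVec m) →
    PAdicConeGen p a → PAdicSubspaceGen p a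
proposition3p3 p _ n m a coneGen x (coeff , comb)
  with coneGen (λ j → x j ℤ.+ + Σ∣↥∣ coeff ℤ.* columnSum a j) (InCone-shift a coeff x comb)
... | μ , μ-nonneg-pAdic , μ-comb =
  (λ i → μ i + ι (ℤ.- + Σ∣↥∣ coeff)) ,
  (λ i → IsPAdic-+ι p (μ i) (ℤ.- + Σ∣↥∣ coeff) (proj₂ (μ-nonneg-pAdic i))) ,
  IsCombination-unshift a μ x (+ Σ∣↥∣ coeff) μ-comb
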